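{- Let $n \ge 1$ and let $\Delta_0, \ldots, \Delta_n$ be positive integers. Then there exist indices $\alpha, \beta \in \{0, \ldots, n\}$ such that: (1) $\alpha < \beta$; (2) $\Delta_j > \max(\Delta_\alpha, \Delta_\beta)$ for every $j \in \{0, \ldots, \alpha - 1\} \cup \{\beta + 1, \ldots, n\}$; (3) there is at most one index $t \in \{\alpha, \ldots, \beta\}$ with $\Delta_t < \max(\Delta_\alpha, \Delta_\beta)$. -}

module Defs where

{-# OPTIONS --safe #-}
module Submission where

-- Descend through pairs with everything outside them strictly higher.  For such a
-- pair (a, b) of height M = max (Δ a) (Δ b), look at the indices of [a, b] with
-- Δ < M.  If there is at most one, (a, b) works.  Otherwise the first and last of
-- them form a new pair: whatever lies outside it is either outside [a, b] (height
-- above M) or inside [a, b] but not below M, and its own height is below M.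
-- Heights strictly decrease, so the descent, started at (0, n), terminates.

open import Defs
open import Data.Nat using (ℕ; zero; suc; _<_; _≤_; _⊔_; z≤n; s≤s; _<?_)
open import Data.Nat.Properties using (≤-reflexive; <⇒≤; <⇒≱; ≮⇒≥; <-≤-trans; ⊔-lub)
open import Data.Nat.Induction using (<-rec)
open import Data.Fin using (Fin; zero; suc; toℕ; fromℕ)
open import Data.Fin.Properties using (toℕ-fromℕ; ≤fromℕ) renaming (_≤?_ to _≤ᶠ?_; _<?_ to _<ᶠ?_)
open import Data.Product using (∃₂; _×_; _,_; proj₁; proj₂)
open import Data.Sum using (_⊎_; inj₁; inj₂; [_,_])
open import Data.Empty using (⊥-elim)
open import Function using (_∘_)
open import Level using (Level; 0ℓ)
open import Relation.Nullary using (¬_; yes; no; contradiction)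
open import Relation.Nullary.Decidable using (_×-dec_)
open import Relation.Unary using (Pred; Decidable)
open import Relation.Binary.PropositionalEquality using (_≡_; refl; sym; trans; cong; subst)

data Occurrences {p : Level} {m : ℕ} (P : Pred (Fin m) p) : Set p where
  none : (∀ i → ¬ P i) → Occurrences P
  one  : ∀ i → P i → (∀ j → P j → j ≡ i) → Occurrences P
  span : ∀ i j → toℕ i < toℕ j → P i → P j →
         (∀ t → P t → toℕ i ≤ toℕ t × toℕ t ≤ toℕ j) → Occurrences P

occurrences : ∀ {p m} {P : Pred (Fin m) p} → Decidable P → Occurrences P
occurrences {m = zero} P? = none λ ()
occurrences {m = suc m} {P} P? with P? zero | occurrences {P = P ∘ suc} (P? ∘ suc)
... | no ¬p₀ | none ¬p = none λ { zero → ¬p₀ ; (suc i) → ¬p i }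
... | yes p₀ | none ¬p = one zero p₀ λ { zero _ → refl ; (suc j) pj → ⊥-elim (¬p j pj) }
... | no ¬p₀ | one i pi unique =
  one (suc i) pi λ { zero p → ⊥-elim (¬p₀ p) ; (suc j) pj → cong suc (unique j pj) }
... | yes p₀ | one i pi unique =
  span zero (suc i) (s≤s z≤n) p₀ pi
    λ { zero _ → z≤n , z≤n ; (suc t) pt → z≤n , ≤-reflexive (cong (toℕ ∘ suc) (unique t pt)) }
... | no ¬p₀ | span i j i<j pi pj within =
  span (suc i) (suc j) (s≤s i<j) pi pj
    λ { zero p → ⊥-elim (¬p₀ p) ; (suc t) pt → s≤s (proj₁ (within t pt)) , s≤s (proj₂ (within t pt)) }
... | yes p₀ | span i j _ _ pj within =
  span zero (suc j) (s≤s z≤n) p₀ pj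
    λ { zero _ → z≤n , z≤n ; (suc t) pt → z≤n , s≤s (proj₂ (within t pt)) }

module Valleys {m : ℕ} (Δ : Fin m → ℕ) where

  height : Fin m → Fin m → ℕ
  height a b = Δ a ⊔ Δ b

  Enclosed : Fin m → Fin m → Set
  Enclosed a b = ∀ j → toℕ j < toℕ a ⊎ toℕ b < toℕ j → height a b < Δ j

  Dip : Fin m → Fin m → Pred (Fin m) 0ℓ
  Dip a b t = toℕ a ≤ toℕ t × toℕ t ≤ toℕ b × Δ t < height a b

  dip? : ∀ a b → Decidable (Dip a b)
  dip? a b t = (a ≤ᶠ? t) ×-dec (t ≤ᶠ? b) ×-dec (Δ t <? height a b)

  UniqueDip : Fin m → Fin m → Set
  UniqueDip a b = ∀ t t′ →
    toℕ a ≤ toℕ t → toℕ t ≤ toℕ b → Δ t < height a b →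
    toℕ a ≤ toℕ t′ → toℕ t′ ≤ toℕ b → Δ t′ < height a b →
    t ≡ t′

  Valley : Set
  Valley = ∃₂ λ α β → toℕ α < toℕ β × Enclosed α β × UniqueDip α β

  enclosed-between-dips : ∀ {a b a′ b′} → Enclosed a b →
    (∀ t → Dip a b t → toℕ a′ ≤ toℕ t × toℕ t ≤ toℕ b′) →
    height a′ b′ < height a b → Enclosed a′ b′
  enclosed-between-dips {a} {b} {a′} {b′} enclosed within lower j outside′ =
    <-≤-trans lower height≤Δj
    where
    not-within : ¬ (toℕ a′ ≤ toℕ j × toℕ j ≤ toℕ b′)
    not-within (a′≤j , j≤b′) = [ (λ j<a′ → <⇒≱ j<a′ a′≤j) , (λ b′<j → <⇒≱ b′<j j≤b′) ] outside′

    height≤Δj : height a b ≤ Δ j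
    height≤Δj with j <ᶠ? a | b <ᶠ? j
    ... | yes j<a | _       = <⇒≤ (enclosed j (inj₁ j<a))
    ... | no _    | yes b<j = <⇒≤ (enclosed j (inj₂ b<j))
    ... | no j≮a  | no b≮j  =
      ≮⇒≥ λ low → not-within (within j (≮⇒≥ j≮a , ≮⇒≥ b≮j , low))

  Descent : ℕ → Set
  Descent h = ∀ {a b} → height a b ≡ h → toℕ a < toℕ b → Enclosed a b → Valley

  descend : ∀ h → Descent h
  descend = <-rec Descent step
    where
    step : ∀ h → (∀ {h′} → h′ < h → Descent h′) → Descent h
    step _ descend′ {a} {b} refl a<b enclosed with occurrences (dip? a b)
    ... | none nodip =
      a , b , a<b , enclosed , λ t _ a≤t t≤b low _ _ _ → ⊥-elim (nodip t (a≤t , t≤b , low))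
    ... | one _ _ unique =
      a , b , a<b , enclosed ,
      λ t t′ a≤t t≤b low a≤t′ t′≤b low′ →
        trans (unique t (a≤t , t≤b , low)) (sym (unique t′ (a≤t′ , t′≤b , low′)))
    ... | span a′ b′ a′<b′ (_ , _ , low-a′) (_ , _ , low-b′) within =
      descend′ lower refl a′<b′ (enclosed-between-dips enclosed within lower)
      where
      lower : height a′ b′ < height a b
      lower = ⊔-lub low-a′ low-b′

lemma2p8 : (n : ℕ) → 1 ≤ n → (Δ : Fin (suc n) → ℕ) → (∀ i → 0 < Δ i) →
    ∃₂ λ (α β : Fin (suc n)) →
      (toℕ α < toℕ β)
      × (∀ (j : Fin (suc n)) → (toℕ j < toℕ α ⊎ toℕ β < toℕ j) → Δ α ⊔ Δ β < Δ j)
      × (∀ (t t′ : Fin (suc n)) →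
           toℕ α ≤ toℕ t → toℕ t ≤ toℕ β → Δ t < Δ α ⊔ Δ β →
           toℕ α ≤ toℕ t′ → toℕ t′ ≤ toℕ β → Δ t′ < Δ α ⊔ Δ β →
           t ≡ t′)
lemma2p8 n 1≤n Δ _ = descend (height zero (fromℕ n)) refl 0<n enclosed-full
  where
  open Valleys Δ

  0<n : toℕ (zero {n}) < toℕ (fromℕ n)
  0<n = subst (0 <_) (sym (toℕ-fromℕ n)) 1≤n

  enclosed-full : Enclosed zero (fromℕ n)
  enclosed-full j (inj₂ last<j) = contradiction (≤fromℕ j) (<⇒≱ last<j)
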